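{- Let $s \ge 1$ be an integer, let $p \equiv 1 \pmod{2s}$ be prime, and let $S = \pm\{d_1, d_2, \dots, d_s\} \subseteq \mathbb{Z}_p^*$. Suppose $a$ and $b$ are positive integers with $2abs = p - 1$, let $G = (\mathbb{Z}_p^*)^b$ and $H = (\mathbb{Z}_p^*)^{bs}$. If $d_1, d_2, \dots, d_s$ represent the $s$ distinct cosets of $H$ in $G$, then there exists a $2s$-factorisation of $K_p$ into $\mathrm{Cay}(\mathbb{Z}_p; S)$.
   Context: $\mathbb{Z}_p^*$ is the multiplicative group of units modulo $p$, and $(\mathbb{Z}_p^*)^m = \{x^m : x \in \mathbb{Z}_p^*\}$. $\pm\{d_1,\dots,d_s\}$ denotes $\{\pm d_1,\dots,\pm d_s\}$. The Cayley graph $\mathrm{Cay}(\mathbb{Z}_p;S)$ has vertex set $\mathbb{Z}_p$, with $x$ adjacent to $x+t$ for each $t\in S$. A $k$-factorisation of a graph into $X$ is a decomposition of its edge set into edge-disjoint spanning $k$-regular subgraphs each isomorphic to $X$. -}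

module Defs where

open import Data.Nat using (ℕ; zero; suc; _+_; _*_; _∸_; _^_; _≡ᵇ_; NonZero)
open import Data.Nat.DivMod using (_%_)
open import Data.Fin using (Fin; toℕ)
open import Data.Fin.Properties using () renaming (_≟_ to _≟ᶠ_)
open import Data.Bool using (Bool; true; false; if_then_else_; not)
open import Data.List using (List; map; allFin; concatMap; _∷_; [])
open import Data.Nat.ListAction using (sum)
open import Data.Bool.ListAction using (any)
open import Data.Product using (Σ; ∃; _×_; _,_)
open import Relation.Binary.PropositionalEquality using (_≡_; _≢_)
open import Relation.Nullary using (¬_)
open import Relation.Nullary.Decidable using (⌊_⌋)
open import Function.Bundles using (_↔_; Inverse)

Graph : ℕ → Set
Graph n = Fin n → Fin n → Bool

K : (n : ℕ) → Graph n
K n x y = not ⌊ x ≟ᶠ y ⌋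

degree : {n : ℕ} → Graph n → Fin n → ℕ
degree {n} X x = sum (map (λ y → if X x y then 1 else 0) (allFin n))

Regular : {n : ℕ} → ℕ → Graph n → Set
Regular k X = ∀ x → degree X x ≡ k

SpanningSubgraph : {n : ℕ} → Graph n → Graph n → Set
SpanningSubgraph X Y = ∀ x y → X x y ≡ true → Y x y ≡ true

_≅_ : {n : ℕ} → Graph n → Graph n → Set
_≅_ {n} X Y = Σ (Fin n ↔ Fin n) λ σ → ∀ x y → X x y ≡ Y (Inverse.to σ x) (Inverse.to σ y)

Factorisation : {n : ℕ} → ℕ → Graph n → Graph n → Set
Factorisation {n} k Γ X =
  Σ ℕ λ m → Σ (Fin m → Graph n) λ F →
      (∀ i → SpanningSubgraph (F i) Γ)
    × (∀ i → Regular k (F i))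
    × (∀ i → F i ≅ X)
    × (∀ i j x y → i ≢ j → F i x y ≡ true → F j x y ≡ false)
    × (∀ x y → Γ x y ≡ true → ∃ λ i → F i x y ≡ true)

module _ (p : ℕ) .{{_ : NonZero p}} where

  plusMinus : {s : ℕ} → (Fin s → ℕ) → List ℕ
  plusMinus {s} d = concatMap (λ i → d i % p ∷ ((p ∸ d i % p) % p) ∷ []) (allFin s)

  Cay : List ℕ → Graph p
  Cay S x y = any (λ t → ((toℕ x + t) % p) ≡ᵇ toℕ y) S

  Unit : ℕ → Set
  Unit x = x % p ≢ 0

  InPow : ℕ → ℕ → Set
  InPow m g = ∃ λ x → Unit x × (x ^ m) % p ≡ g % p

  SameCoset : ℕ → ℕ → ℕ → Set
  SameCoset m x y = ∃ λ h → InPow m h × (x * h) % p ≡ y % p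

module Submission where

-- Let G = (Z_p^*)^b ⊇ H = (Z_p^*)^{bs}. Fibres of x ↦ k·x^{bs} have at most bs elements
-- (a polynomial has no more roots than its degree), so every coset kH has at least 2a
-- elements; by Fermat, H and −1 are roots of x^{2a} − 1 and G consists of roots of x^{2as} − 1.
-- Counting roots then forces −1 ∈ H and G = ⊔ᵢ dᵢH. Splitting H = H⁺ ⊔ −H⁺ by the lower half
-- of the residues gives unique factorisations G = S·H⁺, and with representatives R of the
-- cosets of G every unit is uniquely c·σ with c ∈ T = R·H⁺ and σ ∈ S. So the graphs
-- Cay(Z_p; cS), c ∈ T, partition the edges of K_p, and each is 2s-regular and isomorphic to
-- Cay(Z_p; S) via x ↦ c⁻¹x.

open import Data.Bool using (Bool; true; false; if_then_else_; T)
open import Data.Bool.ListAction using (any)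
open import Data.Bool.Properties using (T-≡; ¬-not; ⇔→≡)
open import Data.Fin using (Fin; toℕ; fromℕ<)
import Data.Fin as Fin
open import Data.Fin.Properties using (toℕ-inject₁; toℕ<n; toℕ-fromℕ; toℕ-fromℕ<; toℕ-injective)
open import Data.List using (List; []; _∷_; length; upTo; applyUpTo; map; filter; allFin; concatMap; lookup)
open import Data.List.Properties using (length-applyUpTo; length-++; length-tabulate; length-map)
open import Data.List.Membership.Propositional using (_∈_; lose; find)
open import Data.List.Membership.Propositional.Properties
  using (∈-upTo⁺; ∈-filter⁺; ∈-filter⁻; ∈-allFin; ∈-concat⁻; ∈-concat⁺′; ∈-map⁺; ∈-map⁻; ∈-lookup)
open import Data.List.Relation.Unary.All as All using (All; []; _∷_)
import Data.List.Relation.Unary.All.Properties as All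
open import Data.List.Relation.Unary.All.Properties using (all-filter)
open import Data.List.Relation.Unary.AllPairs as AllPairs using (AllPairs; []; _∷_)
import Data.List.Relation.Unary.AllPairs.Properties as AllPairsₚ
open import Data.List.Relation.Unary.AllPairs.Properties using (applyUpTo⁺₁)
open import Data.List.Relation.Unary.Any as Any using (Any; here; there; any?; satisfied)
import Data.List.Relation.Unary.Any.Properties as Anyₚ
open import Data.List.Relation.Unary.Any.Properties using (any⁺; any⁻)
open import Data.List.Relation.Unary.Unique.Propositional using (Unique)
open import Data.List.Relation.Unary.Unique.Propositional.Properties using (allFin⁺; upTo⁺)
open import Data.Nat
open import Data.Nat.Combinatorics using (_C_; nCn≡1; nCk≡n!/k![n-k]!; k![n∸k]!∣n!)
open import Data.Nat.DivMod
open import Data.Nat.Divisibility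
open import Data.Nat.ListAction using () renaming (sum to sumˡ)
open import Data.Nat.Primality using (Prime; euclidsLemma; prime⇒nonTrivial)
open import Data.Nat.Properties
open import Data.Nat.Solver using (module +-*-Solver)
open import Data.Product using (_×_; _,_; ∃; proj₁; proj₂)
open import Data.Sum using (_⊎_; inj₁; inj₂; [_,_]′)
open import Data.Vec.Functional using (Vector; init; last; tail)
open import Function using (_∘_; id)
open import Function.Bundles using (Equivalence; _⇔_; mk⇔; mk↔ₛ′)
open import Relation.Binary.Bundles using (Setoid)
open import Relation.Binary.PropositionalEquality
import Relation.Binary.Reasoning.Setoid as SetoidReasoning
open import Relation.Nullary using (¬_; contradiction; Dec; yes; no; ¬?; map′; does; _×-dec_; T?)
open import Relation.Nullary.Decidable using (does-⇔; decidable-stable)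
open import Relation.Unary using (Decidable)
open import Algebra.Definitions.RawMonoid +-0-rawMonoid using () renaming (sum to sumᵛ; _×_ to _×ᴹ_)
open import Algebra.Properties.CommutativeSemiring.Binomial +-*-commutativeSemiring using (theorem; binomialTerm)
import Algebra.Properties.CommutativeSemigroup as CommSemigroupProperties
open import Algebra.Properties.Monoid.Sum +-0-monoid using (sum-init-last)
open import Algebra.Properties.Semiring.Exp +-*-semiring using () renaming (_^_ to _^ᴿ_)
open import Defs

open +-*-Solver

module +-CS = CommSemigroupProperties +-commutativeSemigroup
module *-CS = CommSemigroupProperties *-commutativeSemigroup

private variable A B : Set

-- Sums and counting over lists

∑ : List A → (A → ℕ) → ℕ
∑ xs f = sumˡ (map f xs)

ind : Bool → ℕ
ind b = if b then 1 else 0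

count : {P : A → Set} → Decidable P → List A → ℕ
count P? xs = ∑ xs (λ x → ind (does (P? x)))

∑-cong : ∀ {f g : A → ℕ} xs → (∀ {x} → x ∈ xs → f x ≡ g x) → ∑ xs f ≡ ∑ xs g
∑-cong []       _   = refl
∑-cong (x ∷ xs) f≡g = cong₂ _+_ (f≡g (here refl)) (∑-cong xs (f≡g ∘ there))

∑-mono-≤ : ∀ {f g : A → ℕ} xs → (∀ {x} → x ∈ xs → f x ≤ g x) → ∑ xs f ≤ ∑ xs g
∑-mono-≤ []       _   = z≤n
∑-mono-≤ (x ∷ xs) f≤g = +-mono-≤ (f≤g (here refl)) (∑-mono-≤ xs (f≤g ∘ there))

∑-distrib-+ : ∀ (f g : A → ℕ) xs → ∑ xs (λ x → f x + g x) ≡ ∑ xs f + ∑ xs g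
∑-distrib-+ f g []       = refl
∑-distrib-+ f g (x ∷ xs) = trans (cong (f x + g x +_) (∑-distrib-+ f g xs))
  (+-CS.interchange (f x) (g x) (∑ xs f) (∑ xs g))

∑-const : ∀ c (xs : List A) → ∑ xs (λ _ → c) ≡ length xs * c
∑-const c []       = refl
∑-const c (x ∷ xs) = cong (c +_) (∑-const c xs)

∑-≥-term : ∀ (f : A → ℕ) {x xs} → x ∈ xs → f x ≤ ∑ xs f
∑-≥-term f {xs = y ∷ ys} (here refl) = m≤m+n (f y) _
∑-≥-term f {xs = y ∷ ys} (there x∈ys) = ≤-trans (∑-≥-term f x∈ys) (m≤n+m _ (f y))

∑-comm : ∀ (xs : List A) (ys : List B) (g : A → B → ℕ) →
         ∑ xs (λ x → ∑ ys (g x)) ≡ ∑ ys (λ y → ∑ xs (λ x → g x y))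
∑-comm []       ys g = sym (trans (∑-const 0 ys) (*-zeroʳ (length ys)))
∑-comm (x ∷ xs) ys g = trans (cong (∑ ys (g x) +_) (∑-comm xs ys g))
  (sym (∑-distrib-+ (g x) (λ y → ∑ xs (λ x′ → g x′ y)) ys))

length≤∑count : ∀ {R : B → A → Set} (R? : ∀ y → Decidable (R y)) xs ys →
                (∀ {x} → x ∈ xs → ∃ λ y → y ∈ ys × R y x) →
                length xs ≤ ∑ ys (λ y → count (R? y) xs)
length≤∑count {R = R} R? xs ys covered = begin
  length xs                                        ≡⟨ *-identityʳ (length xs) ⟨
  length xs * 1                                    ≡⟨ ∑-const 1 xs ⟨
  ∑ xs (λ _ → 1)                                   ≤⟨ ∑-mono-≤ xs (λ x∈xs → counted (covered x∈xs)) ⟩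
  ∑ xs (λ x → ∑ ys (λ y → ind (does (R? y x))))    ≡⟨ ∑-comm xs ys _ ⟩
  ∑ ys (λ y → count (R? y) xs)                     ∎
  where
  open ≤-Reasoning
  counted : ∀ {x} → (∃ λ y → y ∈ ys × R y x) → 1 ≤ ∑ ys (λ y → ind (does (R? y x)))
  counted {x} (y , y∈ys , ryx) with R? y x in eq
  ... | yes _   = ≤-trans (≤-reflexive (cong (ind ∘ does) (sym eq))) (∑-≥-term (λ y → ind (does (R? y x))) y∈ys)
  ... | no ¬ryx = contradiction ryx ¬ryx

length-filter : ∀ {P : A → Set} (P? : Decidable P) xs → length (filter P? xs) ≡ count P? xs
length-filter P? []       = refl
length-filter P? (x ∷ xs) with does (P? x)
... | true  = cong suc (length-filter P? xs)
... | false = length-filter P? xs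

count≡0 : ∀ {P : A → Set} (P? : Decidable P) {xs} → All (¬_ ∘ P) xs → count P? xs ≡ 0
count≡0 P? []              = refl
count≡0 P? {x ∷ _} (¬px ∷ ¬pxs) with P? x
... | yes px = contradiction px ¬px
... | no  _  = count≡0 P? ¬pxs

count≡1 : ∀ {P : A → Set} (P? : Decidable P) {xs z} → Unique xs → z ∈ xs → P z →
          (∀ {x y} → P x → P y → x ≡ y) → count P? xs ≡ 1
count≡1 P? {x ∷ xs} (x∉xs ∷ unique) z∈ pz P-unique with P? x | z∈
... | yes px | _          = cong suc (count≡0 P? (All.map (λ x≢y py → x≢y (P-unique px py)) x∉xs))
... | no ¬px | here refl  = contradiction pz ¬px
... | no ¬px | there z∈xs = count≡1 P? unique z∈xs pz P-unique

ind-any : ∀ (Q : A → Bool) xs → AllPairs (λ a b → T (Q a) → ¬ T (Q b)) xs → ind (any Q xs) ≡ ∑ xs (ind ∘ Q)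
ind-any Q []       _                = refl
ind-any Q (x ∷ xs) (x-excl ∷ excl) with Q x in eq
... | true  = cong suc (sym (count≡0 (T? ∘ Q) (All.map (λ x-excludes-y → x-excludes-y _) x-excl)))
... | false = ind-any Q xs excl

length-concatMap : ∀ (f : A → List B) xs → length (concatMap f xs) ≡ ∑ xs (length ∘ f)
length-concatMap f []       = refl
length-concatMap f (x ∷ xs) = trans (length-++ (f x)) (cong (length (f x) +_) (length-concatMap f xs))

All-concatMap⁺ : ∀ {P : B → Set} (f : A → List B) xs → (∀ x → All P (f x)) → All P (concatMap f xs)
All-concatMap⁺ f xs all-P = All.concat⁺ (All.map⁺ (All.universal all-P xs))

concatMap⁺ : ∀ {R : B → B → Set} (f : A → List B) {xs} → (∀ x → AllPairs R (f x)) →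
             AllPairs (λ x y → ∀ {u v} → u ∈ f x → v ∈ f y → R u v) xs →
             AllPairs R (concatMap f xs)
concatMap⁺ f inside across = AllPairsₚ.concat⁺ (All.map⁺ (All.universal inside _))
  (AllPairsₚ.map⁺ (AllPairs.map (λ R-fx-fy → All.tabulate λ u∈ → All.tabulate λ v∈ → R-fx-fy u∈ v∈) across))

first : {P : A → Set} → Decidable P → A → List A → A
first P? z []       = z
first P? z (x ∷ xs) = if does (P? x) then x else first P? z xs

first-satisfies : ∀ {P : A → Set} (P? : Decidable P) z {xs} → Any P xs → P (first P? z xs)
first-satisfies P? z {x ∷ xs} any-P with P? x
... | yes px = px
... | no ¬px with any-P
...   | here px   = contradiction px ¬px
...   | there pxs = first-satisfies P? z pxs

first-cong : ∀ {P Q : A → Set} (P? : Decidable P) (Q? : Decidable Q) z xs →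
             (∀ x → P x ⇔ Q x) → first P? z xs ≡ first Q? z xs
first-cong P? Q? z []       P⇔Q = refl
first-cong P? Q? z (x ∷ xs) P⇔Q rewrite does-⇔ (P⇔Q x) (P? x) (Q? x) =
  cong (if does (Q? x) then x else_) (first-cong P? Q? z xs P⇔Q)

lookup-injective : ∀ {xs : List A} → Unique xs → ∀ i j → lookup xs i ≡ lookup xs j → i ≡ j
lookup-injective (_ ∷ _)       Fin.zero    Fin.zero    _ = refl
lookup-injective (x∉xs ∷ _)    Fin.zero    (Fin.suc j) x≡xⱼ = contradiction x≡xⱼ (All.lookup x∉xs (∈-lookup j))
lookup-injective (x∉xs ∷ _)    (Fin.suc i) Fin.zero    xᵢ≡x = contradiction (sym xᵢ≡x) (All.lookup x∉xs (∈-lookup i))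
lookup-injective (_ ∷ unique)  (Fin.suc i) (Fin.suc j) xᵢ≡xⱼ = cong Fin.suc (lookup-injective unique i j xᵢ≡xⱼ)

-- Binomial coefficients modulo a prime

prime⇒>1 : ∀ {p} → Prime p → 1 < p
prime⇒>1 {p} pp = nonTrivial⇒n>1 p {{prime⇒nonTrivial pp}}

prime∤! : ∀ {p m} → Prime p → m < p → ¬ p ∣ m !
prime∤! {m = zero}  pp _   p∣1 = <⇒≢ (prime⇒>1 pp) (sym (∣1⇒≡1 p∣1))
prime∤! {m = suc m} pp m<p p∣m! with euclidsLemma (suc m) (m !) pp p∣m!
... | inj₁ p∣1+m = <⇒≱ m<p (∣⇒≤ p∣1+m)
... | inj₂ p∣m!  = prime∤! pp (<-trans (n<1+n m) m<p) p∣m!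

nCk*k![n∸k]!≡n! : ∀ {n k} → k ≤ n → (n C k) * (k ! * (n ∸ k) !) ≡ n !
nCk*k![n∸k]!≡n! {n} {k} k≤n = begin
  (n C k) * (k ! * (n ∸ k) !)                 ≡⟨ cong (_* (k ! * (n ∸ k) !)) (nCk≡n!/k![n-k]! k≤n) ⟩
  n ! / (k ! * (n ∸ k) !) * (k ! * (n ∸ k) !) ≡⟨ m/n*n≡m (k![n∸k]!∣n! k≤n) ⟩
  n !                                         ∎
  where
  open ≡-Reasoning
  instance _ = _!*_!≢0 k (n ∸ k)

-- p divides p! = C(p,k)·k!·(p−k)! but neither of the two factorials.
prime∣C : ∀ {p k} → Prime p → 0 < k → k < p → p ∣ p C k
prime∣C {suc q} {k} pp 0<k k<p
  with euclidsLemma (suc q C k) (k ! * (suc q ∸ k) !) pp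
         (subst (suc q ∣_) (sym (nCk*k![n∸k]!≡n! (<⇒≤ k<p))) (m∣m*n (q !)))
... | inj₁ p∣C = p∣C
... | inj₂ p∣k![p-k]! with euclidsLemma (k !) ((suc q ∸ k) !) pp p∣k![p-k]!
...   | inj₁ p∣k!     = contradiction p∣k! (prime∤! pp k<p)
...   | inj₂ p∣[p-k]! = contradiction p∣[p-k]! (prime∤! pp (∸-monoʳ-< 0<k (<⇒≤ k<p)))

∣-sum : ∀ {d n} (f : Vector ℕ n) → (∀ i → d ∣ f i) → d ∣ sumᵛ f
∣-sum {d} {zero} f d∣f = d ∣0
∣-sum {n = suc n} f d∣f = ∣m∣n⇒∣m+n (d∣f Fin.zero) (∣-sum (tail f) (d∣f ∘ Fin.suc))

-- The library's binomial theorem is stated with the generic semiring power and multiple.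
^ᴿ≡^ : ∀ x n → x ^ᴿ n ≡ x ^ n
^ᴿ≡^ x zero    = refl
^ᴿ≡^ x (suc n) = cong (x *_) (^ᴿ≡^ x n)

×ᴹ≡* : ∀ n x → n ×ᴹ x ≡ n * x
×ᴹ≡* zero    x = refl
×ᴹ≡* (suc n) x = cong (x +_) (×ᴹ≡* n x)

∣m⇒∣m×ᴹn : ∀ {d m} n → d ∣ m → d ∣ m ×ᴹ n
∣m⇒∣m×ᴹn {m = m} n d∣m = subst (_ ∣_) (sym (×ᴹ≡* m n)) (∣m⇒∣m*n n d∣m)

freshmans-dream : ∀ {d} n .{{_ : NonZero d}} → 0 < n → (∀ {k} → 0 < k → k < n → d ∣ n C k) →
                  ∀ x → (x + 1) ^ n % d ≡ (x ^ n + 1) % d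
freshmans-dream {d} (suc m) _ d∣C x = begin
  (x + 1) ^ suc m % d                         ≡⟨ cong (_% d) (trans (sym (^ᴿ≡^ (x + 1) (suc m))) (theorem (suc m) x 1)) ⟩
  (t Fin.zero + sumᵛ (tail t)) % d             ≡⟨ cong (λ s → (t Fin.zero + s) % d) (sum-init-last (tail t)) ⟩
  (t Fin.zero + (middle + last (tail t))) % d ≡⟨ cong₂ (λ a b → (a + (middle + b)) % d) first-term last-term ⟩
  (1 + (middle + x ^ suc m)) % d              ≡⟨ cong (_% d) (+-CS.x∙yz≈zx∙y 1 middle (x ^ suc m)) ⟩
  (x ^ suc m + 1 + middle) % d                ≡⟨ %-remove-+ʳ (x ^ suc m + 1) d∣middle ⟩
  (x ^ suc m + 1) % d                         ∎
  where
  open ≡-Reasoning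
  t : Vector ℕ (suc (suc m))
  t = binomialTerm x 1 (suc m)
  middle : ℕ
  middle = sumᵛ (init (tail t))
  first-term : t Fin.zero ≡ 1
  first-term = trans (+-identityʳ _) (trans (*-identityˡ _) (trans (^ᴿ≡^ 1 (suc m)) (^-zeroˡ (suc m))))
  last-term : last (tail t) ≡ x ^ suc m
  last-term rewrite toℕ-fromℕ m | nCn≡1 (suc m) | n∸n≡0 m =
    trans (+-identityʳ _) (trans (*-identityʳ _) (^ᴿ≡^ x (suc m)))
  d∣middle : d ∣ middle
  d∣middle = ∣-sum (init (tail t)) λ j →
    ∣m⇒∣m×ᴹn _ (d∣C (s≤s z≤n) (s≤s (subst (_< m) (sym (toℕ-inject₁ j)) (toℕ<n j))))

-- Polynomials

-- Coefficient lists, constant term first.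
eval : List ℕ → ℕ → ℕ
eval []       x = 0
eval (c ∷ cs) x = c + x * eval cs x

-- The quotient of f by x − r, by synthetic division.
divide : ℕ → List ℕ → List ℕ
divide r []            = []
divide r (c ∷ [])      = []
divide r (c ∷ cs@(_ ∷ _)) = eval cs r ∷ divide r cs

length-divide : ∀ r c cs → length (divide r (c ∷ cs)) ≡ length cs
length-divide r c []       = refl
length-divide r c (d ∷ cs) = cong suc (length-divide r d cs)

-- f(x) − f(r) = (x − r)·q(x), with both sides moved so that no subtraction occurs.
eval-divide : ∀ f x r → eval f x + r * eval (divide r f) x ≡ eval f r + x * eval (divide r f) x
eval-divide []               x r = trans (*-zeroʳ r) (sym (*-zeroʳ x))
eval-divide (c ∷ [])         x r = solve 3 (λ c x r → c :+ x :* con 0 :+ r :* con 0 := c :+ r :* con 0 :+ x :* con 0) refl c x r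
eval-divide (c ∷ cs@(_ ∷ _)) x r = begin
  c + x * F + r * (R + x * Q)  ≡⟨ solve 6 (λ c x F r R Q → c :+ x :* F :+ r :* (R :+ x :* Q)
                                                       := c :+ r :* R :+ x :* (F :+ r :* Q)) refl c x F r R Q ⟩
  c + r * R + x * (F + r * Q)  ≡⟨ cong (λ z → c + r * R + x * z) (eval-divide cs x r) ⟩
  c + r * R + x * (R + x * Q)  ∎
  where
  open ≡-Reasoning
  F R Q : ℕ
  F = eval cs x
  R = eval cs r
  Q = eval (divide r cs) x

monomial : ℕ → ℕ → List ℕ
monomial k zero    = k ∷ []
monomial k (suc n) = 0 ∷ monomial k n

eval-monomial : ∀ k n x → eval (monomial k n) x ≡ k * x ^ n
eval-monomial k zero    x = trans (cong (k +_) (*-zeroʳ x)) (trans (+-identityʳ k) (sym (*-identityʳ k)))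
eval-monomial k (suc n) x = trans (cong (x *_) (eval-monomial k n x)) (*-CS.x∙yz≈y∙xz x k (x ^ n))

length-monomial : ∀ k n → length (monomial k n) ≡ suc n
length-monomial k zero    = refl
length-monomial k (suc n) = cong suc (length-monomial k n)

-- Arithmetic modulo p

module Modular (p : ℕ) .{{_ : NonZero p}} where

  infix 4 _≋_
  _≋_ : ℕ → ℕ → Set
  a ≋ b = a % p ≡ b % p

  ≋-setoid : Setoid _ _
  ≋-setoid = record
    { Carrier = ℕ ; _≈_ = _≋_
    ; isEquivalence = record { refl = refl ; sym = sym ; trans = trans } }

  module ≋-Reasoning = SetoidReasoning ≋-setoid

  ≋-reflexive : ∀ {a b} → a ≡ b → a ≋ b
  ≋-reflexive = cong (_% p)

  %-≋ : ∀ a → a % p ≋ a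
  %-≋ a = m%n%n≡m%n a p

  1*-≋ : ∀ a → 1 * a ≋ a
  1*-≋ a = ≋-reflexive (*-identityˡ a)

  +-cong : ∀ {a a′ b b′} → a ≋ a′ → b ≋ b′ → a + b ≋ a′ + b′
  +-cong {a} {a′} {b} {b′} a≋a′ b≋b′ = begin
    (a + b) % p               ≡⟨ %-distribˡ-+ a b p ⟩
    (a % p + b % p) % p       ≡⟨ cong₂ (λ u v → (u + v) % p) a≋a′ b≋b′ ⟩
    (a′ % p + b′ % p) % p     ≡⟨ %-distribˡ-+ a′ b′ p ⟨
    (a′ + b′) % p             ∎
    where open ≡-Reasoning

  *-cong : ∀ {a a′ b b′} → a ≋ a′ → b ≋ b′ → a * b ≋ a′ * b′
  *-cong {a} {a′} {b} {b′} a≋a′ b≋b′ = begin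
    (a * b) % p               ≡⟨ %-distribˡ-* a b p ⟩
    (a % p * (b % p)) % p     ≡⟨ cong₂ (λ u v → (u * v) % p) a≋a′ b≋b′ ⟩
    (a′ % p * (b′ % p)) % p   ≡⟨ %-distribˡ-* a′ b′ p ⟨
    (a′ * b′) % p             ∎
    where open ≡-Reasoning

  +-congˡ : ∀ a {b b′} → b ≋ b′ → a + b ≋ a + b′
  +-congˡ a = +-cong {a} refl

  *-congˡ : ∀ a {b b′} → b ≋ b′ → a * b ≋ a * b′
  *-congˡ a = *-cong {a} refl

  *-congʳ : ∀ {a a′} b → a ≋ a′ → a * b ≋ a′ * b
  *-congʳ b a≋a′ = *-cong a≋a′ (refl {x = b % p})

  ^-congˡ : ∀ {a a′} n → a ≋ a′ → a ^ n ≋ a′ ^ n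
  ^-congˡ zero    _    = refl
  ^-congˡ (suc n) a≋a′ = *-cong a≋a′ (^-congˡ n a≋a′)

  0%p : 0 % p ≡ 0
  0%p = m<n⇒m%n≡m (>-nonZero⁻¹ p)

  p≋0 : p ≋ 0
  p≋0 = trans (n%n≡0 p) (sym 0%p)

  <-≋⇒≡ : ∀ {a b} → a < p → b < p → a ≋ b → a ≡ b
  <-≋⇒≡ a<p b<p a≋b = trans (sym (m<n⇒m%n≡m a<p)) (trans a≋b (m<n⇒m%n≡m b<p))

  Distinct : List ℕ → Set
  Distinct = AllPairs (λ a b → ¬ a ≋ b)

  Distinct-upTo : Distinct (upTo p)
  Distinct-upTo = applyUpTo⁺₁ id p λ i<j j<p i≋j →
    <⇒≢ i<j (<-≋⇒≡ (<-trans i<j j<p) j<p i≋j)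

  -- A property invariant under ≋ has a witness iff it has one below p.
  residue? : ∀ {ℓ} {Q : ℕ → Set ℓ} → (∀ {x y} → x ≋ y → Q x → Q y) → Decidable Q → Dec (∃ Q)
  residue? {Q = Q} resp Q? = map′ satisfied search (any? Q? (upTo p))
    where
    search : ∃ Q → Any Q (upTo p)
    search (x , qx) = lose (∈-upTo⁺ (m%n<n x p)) (resp (sym (%-≋ x)) qx)

  -- The additive inverse, represented in {1, …, p} (so neg 0 = p).
  neg : ℕ → ℕ
  neg a = p ∸ a % p

  +-neg-≋0 : ∀ a → a + neg a ≋ 0
  +-neg-≋0 a = begin
    a + neg a            ≈⟨ +-cong (%-≋ a) (refl {x = neg a % p}) ⟨
    a % p + (p ∸ a % p)  ≡⟨ m+[n∸m]≡n (m%n≤n a p) ⟩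
    p                    ≈⟨ p≋0 ⟩
    0                    ∎
    where open ≋-Reasoning

  +-cancelʳ-≋ : ∀ {a b} c → a + c ≋ b + c → a ≋ b
  +-cancelʳ-≋ {a} {b} c a+c≋b+c = begin
    a                  ≡⟨ +-identityʳ a ⟨
    a + 0              ≈⟨ +-congˡ a (+-neg-≋0 c) ⟨
    a + (c + neg c)    ≡⟨ +-assoc a c (neg c) ⟨
    a + c + neg c      ≈⟨ +-cong a+c≋b+c (refl {x = neg c % p}) ⟩
    b + c + neg c      ≡⟨ +-assoc b c (neg c) ⟩
    b + (c + neg c)    ≈⟨ +-congˡ b (+-neg-≋0 c) ⟩
    b + 0              ≡⟨ +-identityʳ b ⟩
    b                  ∎
    where open ≋-Reasoning

  +-cancelˡ-≋ : ∀ a {b c} → a + b ≋ a + c → b ≋ c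
  +-cancelˡ-≋ a {b} {c} ab≋ac = +-cancelʳ-≋ a (trans (≋-reflexive (+-comm b a)) (trans ab≋ac (≋-reflexive (+-comm a c))))

  -- h mod p lies in the lower half of {0, …, p − 1}: this picks one of ±h.
  Positive : ℕ → Set
  Positive h = 2 * (h % p) < p

  Positive? : Decidable Positive
  Positive? h = 2 * (h % p) <? p

  Positive-resp-≋ : ∀ {h h′} → h ≋ h′ → Positive h → Positive h′
  Positive-resp-≋ h≋h′ = subst (λ r → 2 * r < p) h≋h′

  private
    neg-% : ∀ {h} → Unit p h → neg h % p ≡ p ∸ h % p
    neg-% {h} uh = m<n⇒m%n≡m (∸-monoʳ-< (n≢0⇒n>0 uh) (m%n≤n h p))

    r+q≡p : ∀ h → h % p + (p ∸ h % p) ≡ p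
    r+q≡p h = m+[n∸m]≡n (m%n≤n h p)

    doubling : ∀ r q → r + q + (r + q) ≡ 2 * r + 2 * q
    doubling = solve 2 (λ r q → r :+ q :+ (r :+ q) := con 2 :* r :+ con 2 :* q) refl

  -- With r = h mod p and q = p − r we have r + q = p, so at most one of 2r, 2q lies
  -- below p, and exactly one when p is odd.
  Positive-neg⁻ : ∀ {h} → Unit p h → Positive h → ¬ Positive (neg h)
  Positive-neg⁻ {h} uh 2r<p 2q<p = <-irrefl refl (begin-strict
    p + p                  ≡⟨ cong₂ _+_ (r+q≡p h) (r+q≡p h) ⟨
    r + q + (r + q)        ≡⟨ doubling r q ⟩
    2 * r + 2 * q          <⟨ +-mono-< 2r<p (subst (λ x → 2 * x < p) (neg-% uh) 2q<p) ⟩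
    p + p                  ∎)
    where
    open ≤-Reasoning
    r q : ℕ
    r = h % p
    q = p ∸ h % p

  Positive-neg⁺ : ∀ {h k} → p ≡ suc (2 * k) → Unit p h → ¬ Positive h → Positive (neg h)
  Positive-neg⁺ {h} {k} p-odd uh ¬2r<p = subst (λ x → 2 * x < p) (sym (neg-% uh)) (+-cancelʳ-< p (2 * q) p (begin-strict
    2 * q + p              <⟨ +-monoʳ-< (2 * q) p<2r ⟩
    2 * q + 2 * r          ≡⟨ +-comm (2 * q) (2 * r) ⟩
    2 * r + 2 * q          ≡⟨ doubling r q ⟨
    r + q + (r + q)        ≡⟨ cong₂ _+_ (r+q≡p h) (r+q≡p h) ⟩
    p + p                  ∎))
    where
    open ≤-Reasoning
    r q : ℕ
    r = h % p
    q = p ∸ h % p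
    p<2r : p < 2 * r
    p<2r = ≤∧≢⇒< (≮⇒≥ ¬2r<p) λ p≡2r → even≢odd r k (trans (sym p≡2r) p-odd)

module PrimeModular (p : ℕ) .{{_ : NonZero p}} (prime : Prime p) where
  open Modular p

  ∣⇒≋0 : ∀ {a} → p ∣ a → a ≋ 0
  ∣⇒≋0 {a} p∣a = trans (n∣m⇒m%n≡0 a p p∣a) (sym 0%p)

  ≋0⇒∣ : ∀ {a} → a ≋ 0 → p ∣ a
  ≋0⇒∣ {a} a≋0 = m%n≡0⇒n∣m a p (trans a≋0 0%p)

  unit⇒≉0 : ∀ {a} → Unit p a → ¬ a ≋ 0
  unit⇒≉0 u a≋0 = u (trans a≋0 0%p)

  ≉0⇒unit : ∀ {a} → ¬ a ≋ 0 → Unit p a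
  ≉0⇒unit a≉0 a%p≡0 = a≉0 (trans a%p≡0 (sym 0%p))

  unit? : ∀ a → Dec (Unit p a)
  unit? a = ¬? (a % p ≟ 0)

  Unit-resp-≋ : ∀ {a b} → a ≋ b → Unit p a → Unit p b
  Unit-resp-≋ a≋b u b%p≡0 = u (trans a≋b b%p≡0)

  1<p : 1 < p
  1<p = prime⇒>1 prime

  unit-1 : Unit p 1
  unit-1 1%p≡0 = 1≢0 (trans (sym (m<n⇒m%n≡m 1<p)) 1%p≡0)
    where 1≢0 : 1 ≢ 0
          1≢0 ()

  ≋0-product : ∀ {a b} → a * b ≋ 0 → a ≋ 0 ⊎ b ≋ 0
  ≋0-product {a} {b} ab≋0 with euclidsLemma a b prime (≋0⇒∣ ab≋0)
  ... | inj₁ p∣a = inj₁ (∣⇒≋0 p∣a)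
  ... | inj₂ p∣b = inj₂ (∣⇒≋0 p∣b)

  Unit-* : ∀ {a b} → Unit p a → Unit p b → Unit p (a * b)
  Unit-* ua ub = ≉0⇒unit λ ab≋0 → [ unit⇒≉0 ua , unit⇒≉0 ub ]′ (≋0-product ab≋0)

  Unit-^ : ∀ {a} n → Unit p a → Unit p (a ^ n)
  Unit-^ zero    _  = unit-1
  Unit-^ (suc n) ua = Unit-* ua (Unit-^ n ua)

  *-cancelˡ-≋ : ∀ {k a b} → Unit p k → k * a ≋ k * b → a ≋ b
  *-cancelˡ-≋ {k} {a} {b} uk ka≋kb =
    [ (λ k≋0 → contradiction k≋0 (unit⇒≉0 uk))
    , (λ a-b≋0 → +-cancelʳ-≋ (neg b) (trans a-b≋0 (sym (+-neg-≋0 b))))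
    ]′ (≋0-product k[a-b]≋0)
    where
    open ≋-Reasoning
    k[a-b]≋0 : k * (a + neg b) ≋ 0
    k[a-b]≋0 = begin
      k * (a + neg b)       ≡⟨ *-distribˡ-+ k a (neg b) ⟩
      k * a + k * neg b     ≈⟨ +-cong ka≋kb (refl {x = (k * neg b) % p}) ⟩
      k * b + k * neg b     ≡⟨ *-distribˡ-+ k b (neg b) ⟨
      k * (b + neg b)       ≈⟨ *-congˡ k (+-neg-≋0 b) ⟩
      k * 0                 ≡⟨ *-zeroʳ k ⟩
      0                     ∎

  *-cancelʳ-≋ : ∀ {k a b} → Unit p k → a * k ≋ b * k → a ≋ b
  *-cancelʳ-≋ {k} {a} {b} uk ak≋bk =
    *-cancelˡ-≋ uk (trans (≋-reflexive (*-comm k a)) (trans ak≋bk (≋-reflexive (*-comm b k))))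

  fermat-^p : ∀ x → x ^ p ≋ x
  fermat-^p zero    = ≋-reflexive (0^p≡0 p)
    where 0^p≡0 : ∀ n → .{{NonZero n}} → 0 ^ n ≡ 0
          0^p≡0 (suc n) = refl
  fermat-^p (suc x) = begin
    suc x ^ p         ≡⟨ cong (_^ p) (+-comm 1 x) ⟩
    (x + 1) ^ p       ≈⟨ freshmans-dream p (>-nonZero⁻¹ p) (prime∣C prime) x ⟩
    x ^ p + 1         ≈⟨ +-cong (fermat-^p x) (refl {x = 1 % p}) ⟩
    x + 1             ≡⟨ +-comm x 1 ⟩
    suc x             ∎
    where open ≋-Reasoning

  fermat : ∀ {x} → Unit p x → x ^ (p ∸ 1) ≋ 1
  fermat {x} ux = *-cancelˡ-≋ ux (begin
    x * x ^ (p ∸ 1)   ≡⟨ cong (x ^_) (m+[n∸m]≡n (<⇒≤ 1<p)) ⟩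
    x ^ p             ≈⟨ fermat-^p x ⟩
    x                 ≡⟨ *-identityʳ x ⟨
    x * 1             ∎)
    where open ≋-Reasoning

  inv : ℕ → ℕ
  inv x = x ^ (p ∸ 2)

  *-inverseʳ : ∀ {x} → Unit p x → x * inv x ≋ 1
  *-inverseʳ {x} ux = trans (≋-reflexive (cong (x ^_) (sym (+-∸-assoc 1 1<p)))) (fermat ux)

  *-inverseˡ : ∀ {x} → Unit p x → inv x * x ≋ 1
  *-inverseˡ {x} ux = trans (≋-reflexive (*-comm (inv x) x)) (*-inverseʳ ux)

  Unit-inv : ∀ {x} → Unit p x → Unit p (inv x)
  Unit-inv ux = Unit-^ (p ∸ 2) ux

  -1*≋neg : ∀ x → (p ∸ 1) * x ≋ neg x
  -1*≋neg x = +-cancelʳ-≋ x (begin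
    (p ∸ 1) * x + x        ≡⟨ +-comm ((p ∸ 1) * x) x ⟩
    suc (p ∸ 1) * x        ≡⟨ cong (_* x) (m+[n∸m]≡n (<⇒≤ 1<p)) ⟩
    p * x                  ≈⟨ *-congʳ x p≋0 ⟩
    0                      ≈⟨ +-neg-≋0 x ⟨
    x + neg x              ≡⟨ +-comm x (neg x) ⟩
    neg x + x              ∎)
    where open ≋-Reasoning

  -1²≋1 : (p ∸ 1) * (p ∸ 1) ≋ 1
  -1²≋1 = trans (-1*≋neg (p ∸ 1)) (≋-reflexive (begin
    p ∸ (p ∸ 1) % p        ≡⟨ cong (p ∸_) (m<n⇒m%n≡m (∸-monoʳ-< z<s (<⇒≤ 1<p))) ⟩
    p ∸ (p ∸ 1)            ≡⟨ m∸[m∸n]≡n (<⇒≤ 1<p) ⟩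
    1                      ∎))
    where open ≡-Reasoning

  ^-even≋1 : ∀ {x} n → x * x ≋ 1 → x ^ (2 * n) ≋ 1
  ^-even≋1 {x} n x²≋1 = begin
    x ^ (2 * n)            ≡⟨ ^-*-assoc x 2 n ⟨
    (x ^ 2) ^ n            ≈⟨ ^-congˡ n (trans (≋-reflexive (cong (x *_) (*-identityʳ x))) x²≋1) ⟩
    1 ^ n                  ≡⟨ ^-zeroˡ n ⟩
    1                      ∎
    where open ≋-Reasoning

  ≋0-or-*-cancelʳ : ∀ {a b c} → a * c ≋ b * c → c ≋ 0 ⊎ a ≋ b
  ≋0-or-*-cancelʳ {c = c} ac≋bc with c % p ≟ 0 % p
  ... | yes c≋0 = inj₁ c≋0
  ... | no  c≉0 = inj₂ (*-cancelʳ-≋ (≉0⇒unit c≉0) ac≋bc)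

  divide-≋0 : ∀ f r → eval f r ≋ 0 → All (_≋ 0) (divide r f) → All (_≋ 0) f
  divide-≋0 []                r _    _             = []
  divide-≋0 (c ∷ [])          r fr≋0 _             =
    trans (≋-reflexive (sym (trans (cong (c +_) (*-zeroʳ r)) (+-identityʳ c)))) fr≋0 ∷ []
  divide-≋0 (c ∷ cs@(_ ∷ _))  r fr≋0 (csr≋0 ∷ q≋0) = c≋0 ∷ divide-≋0 cs r csr≋0 q≋0
    where
    open ≋-Reasoning
    c≋0 : c ≋ 0
    c≋0 = begin
      c                   ≡⟨ +-identityʳ c ⟨
      c + 0               ≡⟨ cong (c +_) (*-zeroʳ r) ⟨
      c + r * 0           ≈⟨ +-congˡ c (*-congˡ r csr≋0) ⟨
      c + r * eval cs r   ≈⟨ fr≋0 ⟩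
      0                   ∎

  lagrange : ∀ f L → Distinct L → All (λ r → eval f r ≋ 0) L → length f ≤ length L → All (_≋ 0) f
  lagrange []         _       _                _              _         = []
  lagrange f@(c ∷ cs) (r ∷ L) (r≉L ∷ distinct) (fr≋0 ∷ roots) (s≤s len) =
    divide-≋0 f r fr≋0 (lagrange (divide r f) L distinct (quotient-roots L r≉L roots)
      (subst (_≤ length L) (sym (length-divide r c cs)) len))
    where
    quotient-roots : ∀ M → All (λ r′ → ¬ r ≋ r′) M → All (λ r′ → eval f r′ ≋ 0) M →
                     All (λ r′ → eval (divide r f) r′ ≋ 0) M
    quotient-roots []       _            _                = []
    quotient-roots (r′ ∷ M) (r≉r′ ∷ r≉M) (fr′≋0 ∷ roots′) =
      [ id , (λ r′≋r → contradiction (sym r′≋r) r≉r′) ]′ (≋0-or-*-cancelʳ r′q≋rq)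
      ∷ quotient-roots M r≉M roots′
      where
      open ≋-Reasoning
      q : ℕ
      q = eval (divide r f) r′
      r′q≋rq : r′ * q ≋ r * q
      r′q≋rq = +-cancelʳ-≋ (eval f r) (begin
        r′ * q + eval f r   ≡⟨ +-comm (r′ * q) _ ⟩
        eval f r + r′ * q   ≡⟨ eval-divide f r′ r ⟨
        eval f r′ + r * q   ≈⟨ +-cong (trans fr′≋0 (sym fr≋0)) (refl {x = (r * q) % p}) ⟩
        eval f r + r * q    ≡⟨ +-comm (eval f r) _ ⟩
        r * q + eval f r    ∎)

  roots-bound : ∀ {k y} n L → 1 ≤ n → Unit p k → Distinct L → All (λ x → k * x ^ n ≋ y) L →
                length L ≤ n
  roots-bound {k} {y} (suc n) L _ uk distinct roots with length L ≤? suc n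
  ... | yes ≤n = ≤n
  ... | no  ≰n = contradiction (lagrange f L distinct (All.map (λ {x} → root x) roots)
                   (subst (_≤ length L) (sym (cong suc (length-monomial k n))) (≰⇒> ≰n)))
                   λ { (_ ∷ f≋0) → unit⇒≉0 uk (leading f≋0) }
    where
    f : List ℕ
    f = neg y ∷ monomial k n
    root : ∀ x → k * x ^ suc n ≋ y → eval f x ≋ 0
    root x kxⁿ≋y = begin
      neg y + x * eval (monomial k n) x  ≡⟨ cong (λ z → neg y + x * z) (eval-monomial k n x) ⟩
      neg y + x * (k * x ^ n)            ≡⟨ cong (neg y +_) (*-CS.x∙yz≈y∙xz x k (x ^ n)) ⟩
      neg y + k * x ^ suc n              ≈⟨ +-congˡ (neg y) kxⁿ≋y ⟩
      neg y + y                          ≡⟨ +-comm (neg y) y ⟩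
      y + neg y                          ≈⟨ +-neg-≋0 y ⟩
      0                                  ∎
      where open ≋-Reasoning
    leading : ∀ {m} → All (_≋ 0) (monomial k m) → k ≋ 0
    leading {zero}  (k≋0 ∷ []) = k≋0
    leading {suc m} (_ ∷ rest) = leading rest

  ^-distribʳ-* : ∀ x y n → (x * y) ^ n ≡ x ^ n * y ^ n
  ^-distribʳ-* x y zero    = refl
  ^-distribʳ-* x y (suc n) = trans (cong (x * y *_) (^-distribʳ-* x y n))
    (*-CS.interchange x y (x ^ n) (y ^ n))

  InPow[m*n]⇒InPow[m] : ∀ m n {x} → InPow p (m * n) x → InPow p m x
  InPow[m*n]⇒InPow[m] m n (z , uz , zᵐⁿ≋x) = z ^ n , Unit-^ n uz ,
    trans (≋-reflexive (trans (^-*-assoc z n m) (cong (z ^_) (*-comm n m)))) zᵐⁿ≋x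

  InPow-root : ∀ m n {x} → m * n ≡ p ∸ 1 → InPow p m x → x ^ n ≋ 1
  InPow-root m n {x} mn≡p-1 (z , uz , zᵐ≋x) = begin
    x ^ n          ≈⟨ ^-congˡ n zᵐ≋x ⟨
    (z ^ m) ^ n    ≡⟨ trans (^-*-assoc z m n) (cong (z ^_) mn≡p-1) ⟩
    z ^ (p ∸ 1)    ≈⟨ fermat uz ⟩
    1              ∎
    where open ≋-Reasoning

  units : List ℕ
  units = applyUpTo suc (p ∸ 1)

  length-units : length units ≡ p ∸ 1
  length-units = length-applyUpTo suc (p ∸ 1)

  private
    1+i<p : ∀ {i} → i < p ∸ 1 → suc i < p
    1+i<p i<p-1 = subst (_ <_) (m+[n∸m]≡n (<⇒≤ 1<p)) (s≤s i<p-1)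

  All-unit-units : All (Unit p) units
  All-unit-units = All.applyUpTo⁺₁ suc (p ∸ 1) λ i<p-1 1+i≋0 →
    1+n≢0 (<-≋⇒≡ (1+i<p i<p-1) (>-nonZero⁻¹ p) (trans 1+i≋0 (sym 0%p)))

  Distinct-units : Distinct units
  Distinct-units = applyUpTo⁺₁ suc (p ∸ 1) λ i<j j<p-1 1+i≋1+j →
    <⇒≢ i<j (suc-injective (<-≋⇒≡ (1+i<p (<-trans i<j j<p-1)) (1+i<p j<p-1) 1+i≋1+j))

  module _ (m : ℕ) where

    InPow-resp-≋ : ∀ {x y} → x ≋ y → InPow p m x → InPow p m y
    InPow-resp-≋ x≋y (z , uz , zᵐ≋x) = z , uz , trans zᵐ≋x x≋y

    InPow-unit : ∀ {x} → InPow p m x → Unit p x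
    InPow-unit (z , uz , zᵐ≋x) = Unit-resp-≋ zᵐ≋x (Unit-^ m uz)

    InPow-^ : ∀ {x} → Unit p x → InPow p m (x ^ m)
    InPow-^ ux = _ , ux , refl

    InPow-1 : InPow p m 1
    InPow-1 = 1 , unit-1 , ≋-reflexive (^-zeroˡ m)

    InPow-* : ∀ {x y} → InPow p m x → InPow p m y → InPow p m (x * y)
    InPow-* (z , uz , zᵐ≋x) (w , uw , wᵐ≋y) =
      z * w , Unit-* uz uw , trans (≋-reflexive (^-distribʳ-* z w m)) (*-cong zᵐ≋x wᵐ≋y)

    InPow-inv : ∀ {x} → InPow p m x → InPow p m (inv x)
    InPow-inv (z , uz , zᵐ≋x) = inv z , Unit-inv uz , (begin
      inv z ^ m          ≡⟨ ^-*-assoc z (p ∸ 2) m ⟩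
      z ^ ((p ∸ 2) * m)  ≡⟨ cong (z ^_) (*-comm (p ∸ 2) m) ⟩
      z ^ (m * (p ∸ 2))  ≡⟨ ^-*-assoc z m (p ∸ 2) ⟨
      inv (z ^ m)        ≈⟨ ^-congˡ (p ∸ 2) zᵐ≋x ⟩
      inv _              ∎)
      where open ≋-Reasoning

    InPow? : Decidable (InPow p m)
    InPow? y = residue? (λ z≋z′ (uz , zᵐ≋y) → Unit-resp-≋ z≋z′ uz , trans (sym (^-congˡ m z≋z′)) zᵐ≋y)
                          (λ z → unit? z ×-dec (z ^ m % p ≟ y % p))

    SameCoset? : ∀ k → Decidable (SameCoset p m k)
    SameCoset? k y = residue? (λ h≋h′ (hᴴ , kh≋y) → InPow-resp-≋ h≋h′ hᴴ , trans (sym (*-congˡ k h≋h′)) kh≋y)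
                                (λ h → InPow? h ×-dec ((k * h) % p ≟ y % p))

    SameCoset-1⇒InPow : ∀ {y} → SameCoset p m 1 y → InPow p m y
    SameCoset-1⇒InPow (h , hᴴ , 1h≋y) = InPow-resp-≋ (trans (sym (1*-≋ h)) 1h≋y) hᴴ

    SameCoset-sym : ∀ {x y} → Unit p x → SameCoset p m x y → SameCoset p m y x
    SameCoset-sym {x = x} {y} ux (h , hᴴ , xh≋y) = inv h , InPow-inv hᴴ , (begin
      y * inv h          ≈⟨ *-congʳ (inv h) xh≋y ⟨
      x * h * inv h      ≡⟨ *-assoc x h (inv h) ⟩
      x * (h * inv h)    ≈⟨ *-congˡ x (*-inverseʳ (InPow-unit hᴴ)) ⟩
      x * 1              ≡⟨ *-identityʳ x ⟩
      x                  ∎)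
      where open ≋-Reasoning

    SameCoset-trans : ∀ {x y z} → SameCoset p m x y → SameCoset p m y z → SameCoset p m x z
    SameCoset-trans {x = x} {y} {z} (h , hᴴ , xh≋y) (h′ , h′ᴴ , yh′≋z) = h * h′ , InPow-* hᴴ h′ᴴ , (begin
      x * (h * h′)       ≡⟨ *-assoc x h h′ ⟨
      x * h * h′         ≈⟨ *-congʳ h′ xh≋y ⟩
      y * h′             ≈⟨ yh′≋z ⟩
      z                  ∎)
      where open ≋-Reasoning

    cosetElements : ℕ → List ℕ
    cosetElements k = filter (SameCoset? k) (upTo p)

    -- Counting the fibres of x ↦ k xᵐ, each of size at most m by Lagrange.
    coset-size : ∀ k → 1 ≤ m → Unit p k → p ∸ 1 ≤ length (cosetElements k) * m
    coset-size k 1≤m uk = begin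
      p ∸ 1                                   ≡⟨ length-units ⟨
      length units                            ≤⟨ length≤∑count fibre? units kH covered ⟩
      ∑ kH (λ y → count (fibre? y) units)      ≤⟨ ∑-mono-≤ kH (λ {y} _ → fibre-size y) ⟩
      ∑ kH (λ _ → m)                           ≡⟨ ∑-const m kH ⟩
      length kH * m                            ∎
      where
      open ≤-Reasoning
      kH : List ℕ
      kH = cosetElements k
      fibre? : ∀ y x → Dec (k * x ^ m ≋ y)
      fibre? y x = (k * x ^ m) % p ≟ y % p
      covered : ∀ {x} → x ∈ units → ∃ λ y → y ∈ kH × k * x ^ m ≋ y
      covered {x} x∈units = (k * x ^ m) % p ,
        ∈-filter⁺ (SameCoset? k) (∈-upTo⁺ (m%n<n _ p)) (x ^ m , InPow-^ (All.lookup All-unit-units x∈units) , sym (%-≋ _)) ,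
        sym (%-≋ _)
      fibre-size : ∀ y → count (fibre? y) units ≤ m
      fibre-size y = subst (_≤ m) (length-filter (fibre? y) units)
        (roots-bound m (filter (fibre? y) units) 1≤m uk (AllPairsₚ.filter⁺ (fibre? y) Distinct-units)
          (all-filter (fibre? y) units))

-- Cayley graphs on Z_p

module CayleyGraphs (p : ℕ) .{{_ : NonZero p}} (prime : Prime p) where
  open Modular p
  open PrimeModular p prime

  toℕ-% : ∀ (x : Fin p) → toℕ x % p ≡ toℕ x
  toℕ-% x = m<n⇒m%n≡m (toℕ<n x)

  Cay-edge⁻ : ∀ {L x y} → Cay p L x y ≡ true → ∃ λ t → t ∈ L × toℕ x + t ≋ toℕ y
  Cay-edge⁻ {L} {x} {y} xy∈E with find (any⁻ _ L (Equivalence.from T-≡ xy∈E))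
  ... | t , t∈L , x+t≡y = t , t∈L , trans (≡ᵇ⇒≡ _ _ x+t≡y) (sym (toℕ-% y))

  Cay-edge⁺ : ∀ {L x y t} → t ∈ L → toℕ x + t ≋ toℕ y → Cay p L x y ≡ true
  Cay-edge⁺ {L} {y = y} t∈L x+t≋y =
    Equivalence.to T-≡ (any⁺ _ (lose t∈L (≡⇒≡ᵇ _ _ (trans x+t≋y (toℕ-% y)))))

  -- Each t ∈ L gives exactly one neighbour x + t, and distinct t give distinct neighbours.
  Cay-regular : ∀ {L} → Distinct L → Regular (length L) (Cay p L)
  Cay-regular {L} distinct x = begin
    ∑ (allFin p) (λ y → ind (Cay p L x y))                   ≡⟨ ∑-cong (allFin p) (λ {y} _ → ind-any _ L (exclusive y)) ⟩
    ∑ (allFin p) (λ y → ∑ L (λ t → ind (x+ t ≡ᵇ toℕ y)))     ≡⟨ ∑-comm (allFin p) L _ ⟩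
    ∑ L (λ t → ∑ (allFin p) (λ y → ind (x+ t ≡ᵇ toℕ y)))     ≡⟨ ∑-cong L (λ {t} _ → hit-once t) ⟩
    ∑ L (λ _ → 1)                                            ≡⟨ ∑-const 1 L ⟩
    length L * 1                                             ≡⟨ *-identityʳ (length L) ⟩
    length L                                                 ∎
    where
    open ≡-Reasoning
    x+ : ℕ → ℕ
    x+ t = (toℕ x + t) % p
    exclusive : ∀ y → AllPairs (λ a b → T (x+ a ≡ᵇ toℕ y) → ¬ T (x+ b ≡ᵇ toℕ y)) L
    exclusive y = AllPairs.map (λ a≉b x+a≡y x+b≡y →
      a≉b (+-cancelˡ-≋ (toℕ x) (trans (≡ᵇ⇒≡ _ _ x+a≡y) (sym (≡ᵇ⇒≡ _ _ x+b≡y))))) distinct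
    hit-once : ∀ t → ∑ (allFin p) (λ y → ind (x+ t ≡ᵇ toℕ y)) ≡ 1
    hit-once t = count≡1 (λ y → x+ t ≟ toℕ y) (allFin⁺ p) (∈-allFin (fromℕ< (m%n<n _ p)))
      (sym (toℕ-fromℕ< _)) (λ e e′ → toℕ-injective (trans (sym e) e′))

  K-edge⁻ : ∀ {x y} → K p x y ≡ true → x ≢ y
  K-edge⁻ {x} {y} xy∈K x≡y with x Fin.≟ y
  K-edge⁻ () _ | yes _
  ... | no x≢y = x≢y x≡y

  K-edge⁺ : ∀ {x y} → x ≢ y → K p x y ≡ true
  K-edge⁺ {x} {y} x≢y with x Fin.≟ y
  ... | yes x≡y = contradiction x≡y x≢y
  ... | no  _   = refl

  difference-unit : ∀ {x y : Fin p} → x ≢ y → Unit p (toℕ y + neg (toℕ x))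
  difference-unit {x} {y} x≢y = ≉0⇒unit λ y-x≋0 → x≢y (sym (toℕ-injective (<-≋⇒≡ (toℕ<n y) (toℕ<n x)
    (+-cancelʳ-≋ (neg (toℕ x)) (trans y-x≋0 (sym (+-neg-≋0 (toℕ x))))))))

  difference-translate : ∀ (x y : Fin p) → toℕ x + (toℕ y + neg (toℕ x)) ≋ toℕ y
  difference-translate x y = begin
    toℕ x + (toℕ y + neg (toℕ x))   ≡⟨ +-CS.x∙yz≈y∙xz (toℕ x) (toℕ y) _ ⟩
    toℕ y + (toℕ x + neg (toℕ x))   ≈⟨ +-congˡ (toℕ y) (+-neg-≋0 (toℕ x)) ⟩
    toℕ y + 0                       ≡⟨ +-identityʳ (toℕ y) ⟩
    toℕ y                           ∎
    where open ≋-Reasoning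

  scaled : ℕ → List ℕ → List ℕ
  scaled c = map (λ t → (c * t) % p)

  scaled-edge⁻ : ∀ {c L x y} → Cay p (scaled c L) x y ≡ true → ∃ λ σ → σ ∈ L × toℕ x + c * σ ≋ toℕ y
  scaled-edge⁻ {c} xy∈E with Cay-edge⁻ xy∈E
  ... | t , t∈cL , x+t≋y with ∈-map⁻ (λ σ → (c * σ) % p) t∈cL
  ...   | σ , σ∈L , refl = σ , σ∈L , trans (+-congˡ _ (sym (%-≋ (c * σ)))) x+t≋y

  scaled-edge⁺ : ∀ {c L x y σ} → σ ∈ L → toℕ x + c * σ ≋ toℕ y → Cay p (scaled c L) x y ≡ true
  scaled-edge⁺ {c} {σ = σ} σ∈L x+cσ≋y =
    Cay-edge⁺ (∈-map⁺ (λ σ → (c * σ) % p) σ∈L) (trans (+-congˡ _ (%-≋ (c * σ))) x+cσ≋y)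

  Distinct-scaled : ∀ {c L} → Unit p c → Distinct L → Distinct (scaled c L)
  Distinct-scaled uc distinct =
    AllPairsₚ.map⁺ (AllPairs.map (λ σ≉σ′ cσ≋cσ′ →
      σ≉σ′ (*-cancelˡ-≋ uc (trans (sym (%-≋ _)) (trans cσ≋cσ′ (%-≋ _))))) distinct)

  scale : ℕ → Fin p → Fin p
  scale c x = fromℕ< (m%n<n (c * toℕ x) p)

  toℕ-scale : ∀ c x → toℕ (scale c x) ≋ c * toℕ x
  toℕ-scale c x = trans (≋-reflexive (toℕ-fromℕ< _)) (%-≋ _)

  scale-inverse : ∀ c d → d * c ≋ 1 → ∀ x → scale d (scale c x) ≡ x
  scale-inverse c d dc≋1 x = toℕ-injective (<-≋⇒≡ (toℕ<n _) (toℕ<n x) (begin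
    toℕ (scale d (scale c x))   ≈⟨ toℕ-scale d (scale c x) ⟩
    d * toℕ (scale c x)         ≈⟨ *-congˡ d (toℕ-scale c x) ⟩
    d * (c * toℕ x)             ≡⟨ *-assoc d c (toℕ x) ⟨
    d * c * toℕ x               ≈⟨ *-congʳ (toℕ x) dc≋1 ⟩
    1 * toℕ x                   ≡⟨ *-identityˡ (toℕ x) ⟩
    toℕ x                       ∎))
    where open ≋-Reasoning

  scale-translate : ∀ {c} → Unit p c → ∀ x σ → toℕ (scale (inv c) x) + σ ≋ inv c * (toℕ x + c * σ)
  scale-translate {c} uc x σ = begin
    toℕ (scale (inv c) x) + σ       ≈⟨ +-cong (toℕ-scale (inv c) x) (refl {x = σ % p}) ⟩
    inv c * toℕ x + σ               ≡⟨ cong (inv c * toℕ x +_) (*-identityˡ σ) ⟨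
    inv c * toℕ x + 1 * σ           ≈⟨ +-congˡ (inv c * toℕ x) (*-congʳ σ (*-inverseˡ uc)) ⟨
    inv c * toℕ x + inv c * c * σ   ≡⟨ cong (inv c * toℕ x +_) (*-assoc (inv c) c σ) ⟩
    inv c * toℕ x + inv c * (c * σ) ≡⟨ *-distribˡ-+ (inv c) (toℕ x) (c * σ) ⟨
    inv c * (toℕ x + c * σ)         ∎
    where open ≋-Reasoning

  -- Multiplication by c⁻¹ maps the edge x ~ x + cσ to c⁻¹x ~ c⁻¹x + σ.
  Cay-scaled-≅ : ∀ {c} L → Unit p c → Cay p (scaled c L) ≅ Cay p L
  Cay-scaled-≅ {c} L uc =
    mk↔ₛ′ (scale (inv c)) (scale c) (scale-inverse c (inv c) (*-inverseˡ uc)) (scale-inverse (inv c) c (*-inverseʳ uc)) ,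
    λ x y → ⇔→≡ (mk⇔ (forward x y) (backward x y))
    where
    forward : ∀ x y → Cay p (scaled c L) x y ≡ true → Cay p L (scale (inv c) x) (scale (inv c) y) ≡ true
    forward x y xy∈E =
      let (σ , σ∈L , x+cσ≋y) = scaled-edge⁻ {c} {L} xy∈E
      in  Cay-edge⁺ σ∈L (trans (scale-translate uc x σ) (trans (*-congˡ (inv c) x+cσ≋y) (sym (toℕ-scale (inv c) y))))
    backward : ∀ x y → Cay p L (scale (inv c) x) (scale (inv c) y) ≡ true → Cay p (scaled c L) x y ≡ true
    backward x y xy∈E =
      let (σ , σ∈L , x′+σ≋y′) = Cay-edge⁻ {L} xy∈E
      in  scaled-edge⁺ {c} {L} {x} {y} σ∈L (*-cancelˡ-≋ (Unit-inv uc)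
            (trans (sym (scale-translate uc x σ)) (trans x′+σ≋y′ (toℕ-scale (inv c) y))))

-- The factorisation

module CayleyFactorisation
  (p : ℕ) .{{_ : NonZero p}} (prime : Prime p) (s a b : ℕ) (1≤s : 1 ≤ s) (1≤a : 1 ≤ a) (1≤b : 1 ≤ b)
  (2abs≡p-1 : 2 * a * b * s ≡ p ∸ 1) (d : Fin s → ℕ) (d∈G : ∀ i → InPow p b (d i))
  (d-cosets : ∀ i j → i ≢ j → ¬ SameCoset p (b * s) (d i) (d j))
  where

  open Modular p
  open PrimeModular p prime
  open CayleyGraphs p prime

  bs : ℕ
  bs = b * s

  bs*2a≡p-1 : bs * (2 * a) ≡ p ∸ 1
  bs*2a≡p-1 = trans (solve 3 (λ a b s → b :* s :* (con 2 :* a) := con 2 :* a :* b :* s) refl a b s) 2abs≡p-1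

  b*2as≡p-1 : b * (2 * a * s) ≡ p ∸ 1
  b*2as≡p-1 = trans (solve 3 (λ a b s → b :* (con 2 :* a :* s) := con 2 :* a :* b :* s) refl a b s) 2abs≡p-1

  p-odd : p ≡ suc (2 * (a * b * s))
  p-odd = trans (sym (m+[n∸m]≡n (<⇒≤ 1<p)))
    (cong suc (trans (sym 2abs≡p-1) (solve 3 (λ a b s → con 2 :* a :* b :* s := con 2 :* (a :* b :* s)) refl a b s)))

  1≤bs : 1 ≤ bs
  1≤bs = *-mono-≤ 1≤b 1≤s

  1≤2a : 1 ≤ 2 * a
  1≤2a = *-mono-≤ {1} {2} (s≤s z≤n) 1≤a

  coset-size-≥2a : ∀ k → Unit p k → 2 * a ≤ length (cosetElements bs k)
  coset-size-≥2a k uk = *-cancelʳ-≤ (2 * a) _ bs {{>-nonZero 1≤bs}}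
    (subst (_≤ length (cosetElements bs k) * bs) (trans (sym bs*2a≡p-1) (*-comm bs (2 * a))) (coset-size bs k 1≤bs uk))

  Distinct-cosetElements : ∀ k → Distinct (cosetElements bs k)
  Distinct-cosetElements k = AllPairsₚ.filter⁺ (SameCoset? bs k) Distinct-upTo

  in-coset : ∀ k {y} → y ∈ cosetElements bs k → SameCoset p bs k y
  in-coset k y∈ = proj₂ (∈-filter⁻ (SameCoset? bs k) {xs = upTo p} y∈)

  SameCoset-respʳ-≋ : ∀ k {y y′} → SameCoset p bs k y → y ≋ y′ → SameCoset p bs k y′
  SameCoset-respʳ-≋ k (h , hᴴ , kh≋y) y≋y′ = h , hᴴ , trans kh≋y y≋y′

  -- H has at least 2a elements, all roots of x^(2a) − 1, and so is −1: no room for −1 outside H.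
  ¬¬-1∈H : ¬ ¬ InPow p bs (p ∸ 1)
  ¬¬-1∈H -1∉H = <⇒≱ (s≤s (coset-size-≥2a 1 unit-1)) (roots-bound (2 * a) L 1≤2a unit-1 distinct roots)
    where
    L : List ℕ
    L = (p ∸ 1) ∷ cosetElements bs 1
    distinct : Distinct L
    distinct = All.tabulate (λ {y} y∈H -1≋y →
                 -1∉H (InPow-resp-≋ bs {y} {p ∸ 1} (sym -1≋y) (SameCoset-1⇒InPow bs {y} (in-coset 1 y∈H))))
             ∷ Distinct-cosetElements 1
    roots : All (λ x → 1 * x ^ (2 * a) ≋ 1) L
    roots = trans (1*-≋ _) (^-even≋1 a -1²≋1)
          ∷ All.tabulate λ {y} y∈H → trans (1*-≋ _)
              (InPow-root bs (2 * a) bs*2a≡p-1 (SameCoset-1⇒InPow bs (in-coset 1 y∈H)))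

  -1∈H : InPow p bs (p ∸ 1)
  -1∈H = decidable-stable (InPow? bs (p ∸ 1)) ¬¬-1∈H

  dᵢ-unit : ∀ i → Unit p (d i)
  dᵢ-unit i = InPow-unit b (d∈G i)

  dᵢH⊆G : ∀ i {y} → SameCoset p bs (d i) y → InPow p b y
  dᵢH⊆G i (h , hᴴ , dh≋y) = InPow-resp-≋ b dh≋y (InPow-* b (d∈G i) (InPow[m*n]⇒InPow[m] b s hᴴ))

  -- Otherwise g would be a root of x^(2as) − 1 besides the at least 2as elements of the cosets dᵢH.
  ¬¬cover : ∀ {g} → InPow p b g → ¬ ¬ Any (λ i → SameCoset p bs (d i) g) (allFin s)
  ¬¬cover {g} gᴳ ∄i = <⇒≱ (s≤s size) (roots-bound (2 * a * s) L 1≤2as unit-1 distinct-cover roots)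
    where
    coset : Fin s → List ℕ
    coset i = cosetElements bs (d i)
    cosets : List ℕ
    cosets = concatMap coset (allFin s)
    L : List ℕ
    L = g ∷ cosets
    1≤2as : 1 ≤ 2 * a * s
    1≤2as = *-mono-≤ 1≤2a 1≤s
    size : 2 * a * s ≤ length cosets
    size = begin
      2 * a * s                         ≡⟨ *-comm (2 * a) s ⟩
      s * (2 * a)                       ≡⟨ cong (_* (2 * a)) (length-tabulate {n = s} id) ⟨
      length (allFin s) * (2 * a)       ≡⟨ ∑-const (2 * a) (allFin s) ⟨
      ∑ (allFin s) (λ _ → 2 * a)        ≤⟨ ∑-mono-≤ (allFin s) (λ {i} _ → coset-size-≥2a (d i) (dᵢ-unit i)) ⟩
      ∑ (allFin s) (length ∘ coset)     ≡⟨ length-concatMap coset (allFin s) ⟨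
      length cosets                     ∎
      where open ≤-Reasoning
    distinct-cover : Distinct L
    distinct-cover = All-concatMap⁺ coset (allFin s) (λ i → All.tabulate λ {y} y∈ g≋y →
                 ∄i (lose (∈-allFin i) (SameCoset-respʳ-≋ (d i) {y} {g} (in-coset (d i) y∈) (sym g≋y))))
             ∷ concatMap⁺ coset (λ i → Distinct-cosetElements (d i))
                 (AllPairs.map (λ {i} {j} i≢j {u} {v} u∈ v∈ u≋v → d-cosets i j i≢j
                   (SameCoset-trans bs {d i} {v} {d j} (SameCoset-respʳ-≋ (d i) {u} {v} (in-coset (d i) u∈) u≋v)
                     (SameCoset-sym bs {d j} {v} (dᵢ-unit j) (in-coset (d j) v∈)))) (allFin⁺ s))
    roots : All (λ x → 1 * x ^ (2 * a * s) ≋ 1) L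
    roots = root gᴳ ∷ All-concatMap⁺ coset (allFin s) (λ i → All.tabulate λ y∈ →
              root (dᵢH⊆G i (in-coset (d i) y∈)))
      where
      root : ∀ {x} → InPow p b x → 1 * x ^ (2 * a * s) ≋ 1
      root xᴳ = trans (1*-≋ _) (InPow-root b (2 * a * s) b*2as≡p-1 xᴳ)

  cover : ∀ {g} → InPow p b g → ∃ λ i → SameCoset p bs (d i) g
  cover {g} gᴳ = satisfied (decidable-stable (any? (λ i → SameCoset? bs (d i) g) (allFin s)) (¬¬cover gᴳ))

  coset-separation : ∀ {i j h h′} → InPow p bs h → InPow p bs h′ → d i * h ≋ d j * h′ → i ≡ j
  coset-separation {i} {j} {h} {h′} hᴴ h′ᴴ dh≋dh′ with i Fin.≟ j
  ... | yes i≡j = i≡j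
  ... | no  i≢j = contradiction (h * inv h′ , InPow-* bs hᴴ (InPow-inv bs h′ᴴ) , dᵢ[h/h′]≋dⱼ) (d-cosets i j i≢j)
    where
    open ≋-Reasoning
    dᵢ[h/h′]≋dⱼ : d i * (h * inv h′) ≋ d j
    dᵢ[h/h′]≋dⱼ = begin
      d i * (h * inv h′)    ≡⟨ *-assoc (d i) h (inv h′) ⟨
      d i * h * inv h′      ≈⟨ *-congʳ (inv h′) dh≋dh′ ⟩
      d j * h′ * inv h′     ≡⟨ *-assoc (d j) h′ (inv h′) ⟩
      d j * (h′ * inv h′)   ≈⟨ *-congˡ (d j) (*-inverseʳ (InPow-unit bs h′ᴴ)) ⟩
      d j * 1               ≡⟨ *-identityʳ (d j) ⟩
      d j                   ∎

  1≉-1 : ¬ 1 ≋ p ∸ 1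
  1≉-1 1≋-1 = even≢odd (a * b * s) 0 (suc-injective (trans (sym p-odd) p≡2))
    where
    1≡p-1 : 1 ≡ p ∸ 1
    1≡p-1 = <-≋⇒≡ 1<p (∸-monoʳ-< z<s (<⇒≤ 1<p)) 1≋-1
    p≡2 : p ≡ 2
    p≡2 = trans (sym (m+[n∸m]≡n (<⇒≤ 1<p))) (cong suc (sym 1≡p-1))

  sgn : Bool → ℕ
  sgn true  = 1
  sgn false = p ∸ 1

  sgn∈H : ∀ ε → InPow p bs (sgn ε)
  sgn∈H true  = InPow-1 bs
  sgn∈H false = -1∈H

  sgn²≋1 : ∀ ε → sgn ε * sgn ε ≋ 1
  sgn²≋1 true  = refl
  sgn²≋1 false = -1²≋1

  sgn-injective : ∀ {ε ε′} → sgn ε ≋ sgn ε′ → ε ≡ ε′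
  sgn-injective {true}  {true}  _    = refl
  sgn-injective {false} {false} _    = refl
  sgn-injective {true}  {false} 1≋-1 = contradiction 1≋-1 1≉-1
  sgn-injective {false} {true}  -1≋1 = contradiction (sym -1≋1) 1≉-1

  ±dᵢ∈G : ∀ ε i → InPow p b (sgn ε * d i)
  ±dᵢ∈G ε i = InPow-* b (InPow[m*n]⇒InPow[m] b s (sgn∈H ε)) (d∈G i)

  ±d-injective : ∀ ε ε′ i j → sgn ε * d i ≋ sgn ε′ * d j → i ≡ j × ε ≡ ε′
  ±d-injective ε ε′ i j e = i≡j , sgn-injective (*-cancelʳ-≋ (dᵢ-unit i) ε≋ε′)
    where
    commute : ∀ ε k → d k * sgn ε ≡ sgn ε * d k
    commute ε k = *-comm (d k) (sgn ε)
    i≡j : i ≡ j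
    i≡j = coset-separation (sgn∈H ε) (sgn∈H ε′)
            (trans (≋-reflexive (commute ε i)) (trans e (≋-reflexive (sym (commute ε′ j)))))
    ε≋ε′ : sgn ε * d i ≋ sgn ε′ * d i
    ε≋ε′ = subst (λ k → sgn ε * d i ≋ sgn ε′ * d k) (sym i≡j) e

  S : List ℕ
  S = plusMinus p d

  ±d : Fin s → List ℕ
  ±d i = d i % p ∷ (p ∸ d i % p) % p ∷ []

  ±d-elim : ∀ i {σ} → σ ∈ ±d i → ∃ λ ε → σ ≋ sgn ε * d i
  ±d-elim i (here refl)         = true  , trans (%-≋ (d i)) (sym (1*-≋ (d i)))
  ±d-elim i (there (here refl)) = false , trans (%-≋ (neg (d i))) (sym (-1*≋neg (d i)))

  S-elim : ∀ {σ} → σ ∈ S → ∃ λ i → ∃ λ ε → σ ≋ sgn ε * d i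
  S-elim σ∈S with satisfied (Anyₚ.map⁻ (∈-concat⁻ (map ±d (allFin s)) σ∈S))
  ... | i , σ∈±dᵢ = i , ±d-elim i σ∈±dᵢ

  S-intro : ∀ i ε → ∃ λ σ → σ ∈ S × σ ≋ sgn ε * d i
  S-intro i true  = _ , ∈-concat⁺′ (here refl) (∈-map⁺ ±d (∈-allFin i)) , proj₂ (±d-elim i (here refl))
  S-intro i false = _ , ∈-concat⁺′ (there (here refl)) (∈-map⁺ ±d (∈-allFin i)) , proj₂ (±d-elim i (there (here refl)))

  S⊆G : ∀ {σ} → σ ∈ S → InPow p b σ
  S⊆G σ∈S with S-elim σ∈S
  ... | i , ε , σ≋±dᵢ = InPow-resp-≋ b (sym σ≋±dᵢ) (±dᵢ∈G ε i)

  length-S : length S ≡ 2 * s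
  length-S = begin
    length S                     ≡⟨ length-concatMap ±d (allFin s) ⟩
    ∑ (allFin s) (λ _ → 2)       ≡⟨ ∑-const 2 (allFin s) ⟩
    length (allFin s) * 2        ≡⟨ cong (_* 2) (length-tabulate {n = s} id) ⟩
    s * 2                        ≡⟨ *-comm s 2 ⟩
    2 * s                        ∎
    where open ≡-Reasoning

  Distinct-S : Distinct S
  Distinct-S = concatMap⁺ ±d inside (AllPairs.map across (allFin⁺ s))
    where
    inside : ∀ i → Distinct (±d i)
    inside i = (+≉- ∷ []) ∷ [] ∷ []
      where
      true≢false : true ≢ false
      true≢false ()
      +≉- : ¬ d i % p ≋ (p ∸ d i % p) % p
      +≉- e = true≢false (proj₂ (±d-injective true false i i (trans (sym (proj₂ (±d-elim i (here refl))))
                (trans e (proj₂ (±d-elim i (there (here refl))))))))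
    across : ∀ {i j} → i ≢ j → ∀ {u v} → u ∈ ±d i → v ∈ ±d j → ¬ u ≋ v
    across {i} {j} i≢j u∈ v∈ u≋v with ±d-elim i u∈ | ±d-elim j v∈
    ... | ε , u≋ | ε′ , v≋ = i≢j (proj₁ (±d-injective ε ε′ i j (trans (sym u≋) (trans u≋v v≋))))

  sign-positive : ∀ {h} → Unit p h → ∃ λ ε → Positive (sgn ε * h)
  sign-positive {h} uh with Positive? h
  ... | yes pos = true  , Positive-resp-≋ (sym (1*-≋ h)) pos
  ... | no ¬pos = false , Positive-resp-≋ (sym (-1*≋neg h)) (Positive-neg⁺ {k = a * b * s} p-odd uh ¬pos)

  -- h and −h are never both positive.
  positive-sign-unique : ∀ {h h′} ε ε′ → Unit p h → Unit p h′ → Positive h → Positive h′ →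
                         sgn ε * h ≋ sgn ε′ * h′ → ε ≡ ε′ × h ≋ h′
  positive-sign-unique true  true  _ _ _ _ e = refl , trans (sym (1*-≋ _)) (trans e (1*-≋ _))
  positive-sign-unique false false _ _ _ _ e = refl , *-cancelˡ-≋ (InPow-unit bs -1∈H) e
  positive-sign-unique true  false _  uh′ pos pos′ e =
    contradiction (Positive-resp-≋ (trans (sym (1*-≋ _)) (trans e (-1*≋neg _))) pos) (Positive-neg⁻ uh′ pos′)
  positive-sign-unique false true  uh _   pos pos′ e =
    contradiction (Positive-resp-≋ (trans (sym (1*-≋ _)) (trans (sym e) (-1*≋neg _))) pos′) (Positive-neg⁻ uh pos)

  -- The first unit r < p with c ∈ rG: a canonical representative of the coset cG (0 if c is not a unit).
  rep : ℕ → ℕ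
  rep c = first (λ r → unit? r ×-dec SameCoset? b r c) 0 (upTo p)

  rep-spec : ∀ {c} → Unit p c → Unit p (rep c) × SameCoset p b (rep c) c
  rep-spec {c} uc = first-satisfies (λ r → unit? r ×-dec SameCoset? b r c) 0
    (lose (∈-upTo⁺ (m%n<n c p)) (Unit-resp-≋ (sym (%-≋ c)) uc , 1 , InPow-1 b , c%p*1≋c))
    where
    c%p*1≋c : c % p * 1 ≋ c
    c%p*1≋c = trans (≋-reflexive (*-identityʳ (c % p))) (%-≋ c)

  rep-cong : ∀ {c c′} → Unit p c → SameCoset p b c c′ → rep c ≡ rep c′
  rep-cong {c} {c′} uc c~c′ = first-cong _ _ 0 (upTo p) λ r → mk⇔
    (λ (ur , r~c) → ur , SameCoset-trans b {r} r~c c~c′)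
    (λ (ur , r~c′) → ur , SameCoset-trans b {r} r~c′ (SameCoset-sym b uc c~c′))

  H⁺ : ℕ → Set
  H⁺ h = InPow p bs h × Positive h

  -- c = rep(c)·h with h ∈ H⁺: the elements of the transversal T with Z_p^* = ⊔_{c ∈ T} cS.
  Transversal : ℕ → Set
  Transversal c = c < p × Unit p c × ∃ λ h → H⁺ h × rep c * h ≋ c

  Transversal? : Decidable Transversal
  Transversal? c = c <? p ×-dec unit? c ×-dec
    residue? respects (λ h → (InPow? bs h ×-dec Positive? h) ×-dec (rep c * h % p ≟ c % p))
    where
    respects : ∀ {h h′} → h ≋ h′ → H⁺ h × rep c * h ≋ c → H⁺ h′ × rep c * h′ ≋ c
    respects h≋h′ ((hᴴ , pos) , rh≋c) =
      (InPow-resp-≋ bs h≋h′ hᴴ , Positive-resp-≋ h≋h′ pos) , trans (sym (*-congˡ (rep c) h≋h′)) rh≋c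

  -- With r = rep u, u = r·dᵢh for some h ∈ H; choosing the sign ε with ±h ∈ H⁺ gives
  -- u = c·σ for c = r·(±h) and σ = ±dᵢ ∈ S.
  decompose-with : ∀ {u h} i ε → Unit p u → InPow p bs h → Positive (sgn ε * h) → rep u * (d i * h) ≋ u →
                   ∃ λ c → Transversal c × ∃ λ σ → σ ∈ S × u ≋ c * σ
  decompose-with {u} {h} i ε uu hᴴ pos rdh≋u =
    c , (m%n<n _ p , uc , h′ , (h′ᴴ , pos) , rep-c*h′≋c) , σ , σ∈S , u≋cσ
    where
    open ≋-Reasoning
    r h′ c σ : ℕ
    r = rep u
    h′ = sgn ε * h
    c = (r * h′) % p
    σ = proj₁ (S-intro i ε)
    σ∈S : σ ∈ S
    σ∈S = proj₁ (proj₂ (S-intro i ε))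
    h′ᴴ : InPow p bs h′
    h′ᴴ = InPow-* bs {sgn ε} {h} (sgn∈H ε) hᴴ
    uc : Unit p c
    uc = Unit-resp-≋ {r * h′} {c} (sym (%-≋ (r * h′))) (Unit-* {r} {h′} (proj₁ (rep-spec uu)) (InPow-unit bs {h′} h′ᴴ))
    u≋cσ : u ≋ c * σ
    u≋cσ = begin
      u                                 ≈⟨ rdh≋u ⟨
      r * (d i * h)                     ≡⟨ *-identityʳ _ ⟨
      r * (d i * h) * 1                 ≈⟨ *-congˡ (r * (d i * h)) (sgn²≋1 ε) ⟨
      r * (d i * h) * (sgn ε * sgn ε)   ≡⟨ solve 4 (λ r x h e → r :* (x :* h) :* (e :* e) := r :* (e :* h) :* (e :* x))
                                                   refl r (d i) h (sgn ε) ⟩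
      r * h′ * (sgn ε * d i)            ≈⟨ *-cong (sym (%-≋ (r * h′))) (sym (proj₂ (proj₂ (S-intro i ε)))) ⟩
      c * σ                             ∎
    rep-c*h′≋c : rep c * h′ ≋ c
    rep-c*h′≋c = begin
      rep c * h′     ≡⟨ cong (_* h′) (rep-cong {c} {u} uc (σ , S⊆G {σ} σ∈S , sym u≋cσ)) ⟩
      r * h′         ≈⟨ %-≋ (r * h′) ⟨
      c              ∎

  decompose : ∀ {u} → Unit p u → ∃ λ c → Transversal c × ∃ λ σ → σ ∈ S × u ≋ c * σ
  decompose {u} uu =
    let (_ , g , gᴳ , rg≋u) = rep-spec {u} uu
        (i , h , hᴴ , dh≋g) = cover {g} gᴳ
        (ε , pos)           = sign-positive {h} (InPow-unit bs {h} hᴴ)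
    in  decompose-with i ε uu hᴴ pos (trans (*-congˡ (rep u) dh≋g) rg≋u)

  rep-cong-S : ∀ {c c′ σ σ′} → Unit p c → σ ∈ S → σ′ ∈ S → c * σ ≋ c′ * σ′ → rep c ≡ rep c′
  rep-cong-S {c} {c′} {σ} {σ′} uc σ∈S σ′∈S cσ≋c′σ′ =
    rep-cong uc (σ * inv σ′ , InPow-* b {σ} {inv σ′} (S⊆G σ∈S) (InPow-inv b (S⊆G σ′∈S)) , (begin
      c * (σ * inv σ′)     ≡⟨ *-assoc c σ (inv σ′) ⟨
      c * σ * inv σ′       ≈⟨ *-congʳ (inv σ′) cσ≋c′σ′ ⟩
      c′ * σ′ * inv σ′     ≡⟨ *-assoc c′ σ′ (inv σ′) ⟩
      c′ * (σ′ * inv σ′)   ≈⟨ *-congˡ c′ (*-inverseʳ (InPow-unit b {σ′} (S⊆G σ′∈S))) ⟩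
      c′ * 1               ≡⟨ *-identityʳ c′ ⟩
      c′                   ∎))
    where open ≋-Reasoning

  -- Both sides share the representative r = rep c = rep c′; cancelling it leaves
  -- dᵢ(±h) ≋ dⱼ(±h′), so i = j by coset separation and then h ≋ h′.
  transversal-unique : ∀ {c c′ σ σ′} → Transversal c → Transversal c′ → σ ∈ S → σ′ ∈ S →
                       c * σ ≋ c′ * σ′ → c ≡ c′
  transversal-unique {c} {c′} {σ} {σ′}
    (c<p , uc , h , (hᴴ , pos) , rh≋c) (c′<p , _ , h′ , (h′ᴴ , pos′) , r′h′≋c′) σ∈S σ′∈S cσ≋c′σ′ =
    with-signs (S-elim σ∈S) (S-elim σ′∈S)
    where
    open ≋-Reasoning
    r : ℕ
    r = rep c
    same-rep : rep c ≡ rep c′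
    same-rep = rep-cong-S uc σ∈S σ′∈S cσ≋c′σ′
    rearrange : ∀ x y e → r * (x * (e * y)) ≡ r * y * (e * x)
    rearrange = solve 4 (λ r x y e → r :* (x :* (e :* y)) := r :* y :* (e :* x)) refl r
    with-signs : (∃ λ i → ∃ λ ε → σ ≋ sgn ε * d i) → (∃ λ j → ∃ λ ε′ → σ′ ≋ sgn ε′ * d j) →
                 c ≡ c′
    with-signs (i , ε , σ≋±dᵢ) (j , ε′ , σ′≋±dⱼ) = <-≋⇒≡ c<p c′<p (begin
      c              ≈⟨ rh≋c ⟨
      r * h          ≈⟨ *-congˡ r h≋h′ ⟩
      r * h′         ≡⟨ cong (_* h′) same-rep ⟩
      rep c′ * h′    ≈⟨ r′h′≋c′ ⟩
      c′             ∎)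
      where
      separated : d i * (sgn ε * h) ≋ d j * (sgn ε′ * h′)
      separated = *-cancelˡ-≋ (proj₁ (rep-spec uc)) (begin
        r * (d i * (sgn ε * h))        ≡⟨ rearrange (d i) h (sgn ε) ⟩
        r * h * (sgn ε * d i)          ≈⟨ *-cong rh≋c (sym σ≋±dᵢ) ⟩
        c * σ                          ≈⟨ cσ≋c′σ′ ⟩
        c′ * σ′                        ≈⟨ *-cong (sym r′h′≋c′) σ′≋±dⱼ ⟩
        rep c′ * h′ * (sgn ε′ * d j)   ≡⟨ cong (λ r′ → r′ * h′ * (sgn ε′ * d j)) same-rep ⟨
        r * h′ * (sgn ε′ * d j)        ≡⟨ rearrange (d j) h′ (sgn ε′) ⟨
        r * (d j * (sgn ε′ * h′))      ∎)
      i≡j : i ≡ j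
      i≡j = coset-separation (InPow-* bs {sgn ε} {h} (sgn∈H ε) hᴴ) (InPow-* bs {sgn ε′} {h′} (sgn∈H ε′) h′ᴴ)
              separated
      h≋h′ : h ≋ h′
      h≋h′ = proj₂ (positive-sign-unique ε ε′ (InPow-unit bs {h} hᴴ) (InPow-unit bs {h′} h′ᴴ) pos pos′
        (*-cancelˡ-≋ (dᵢ-unit i) (subst (λ k → d i * (sgn ε * h) ≋ d k * (sgn ε′ * h′)) (sym i≡j) separated)))

  transversalElements : List ℕ
  transversalElements = filter Transversal? (upTo p)

  multiplier : Fin (length transversalElements) → ℕ
  multiplier = lookup transversalElements

  multiplier-transversal : ∀ i → Transversal (multiplier i)
  multiplier-transversal i = proj₂ (∈-filter⁻ Transversal? {xs = upTo p} (∈-lookup i))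

  multiplier-unit : ∀ i → Unit p (multiplier i)
  multiplier-unit i = proj₁ (proj₂ (multiplier-transversal i))

  factor : Fin (length transversalElements) → Graph p
  factor i = Cay p (scaled (multiplier i) S)

  factor-spanning : ∀ i → SpanningSubgraph (factor i) (K p)
  factor-spanning i x y xy∈E = K-edge⁺ λ { refl → loop (scaled-edge⁻ {multiplier i} {S} xy∈E) }
    where
    loop : ¬ ∃ λ σ → σ ∈ S × toℕ x + multiplier i * σ ≋ toℕ x
    loop (σ , σ∈S , x+cσ≋x) = unit⇒≉0 {multiplier i * σ} (Unit-* (multiplier-unit i) (InPow-unit b (S⊆G σ∈S)))
      (+-cancelˡ-≋ (toℕ x) (trans x+cσ≋x (≋-reflexive (sym (+-identityʳ (toℕ x))))))

  factor-regular : ∀ i → Regular (2 * s) (factor i)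
  factor-regular i = subst (λ n → Regular n (factor i)) (trans (length-map _ S) length-S)
    (Cay-regular (Distinct-scaled (multiplier-unit i) Distinct-S))

  factor-≅ : ∀ i → factor i ≅ Cay p S
  factor-≅ i = Cay-scaled-≅ S (multiplier-unit i)

  factors-disjoint : ∀ i j x y → i ≢ j → factor i x y ≡ true → factor j x y ≡ false
  factors-disjoint i j x y i≢j xy∈Eᵢ = ¬-not λ xy∈Eⱼ →
    i≢j (lookup-injective (AllPairsₚ.filter⁺ Transversal? (upTo⁺ p)) i j
      (same-multiplier (scaled-edge⁻ {multiplier i} {S} xy∈Eᵢ) (scaled-edge⁻ {multiplier j} {S} xy∈Eⱼ)))
    where
    same-multiplier : (∃ λ σ → σ ∈ S × toℕ x + multiplier i * σ ≋ toℕ y) →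
                      (∃ λ σ → σ ∈ S × toℕ x + multiplier j * σ ≋ toℕ y) → multiplier i ≡ multiplier j
    same-multiplier (σ , σ∈S , e) (σ′ , σ′∈S , e′) = transversal-unique (multiplier-transversal i) (multiplier-transversal j)
      σ∈S σ′∈S (+-cancelˡ-≋ (toℕ x) (trans e (sym e′)))

  factors-cover : ∀ x y → K p x y ≡ true → ∃ λ i → factor i x y ≡ true
  factors-cover x y xy∈K = edge-in-factor (decompose {u} (difference-unit {x} {y} (K-edge⁻ {x} {y} xy∈K)))
    where
    u : ℕ
    u = toℕ y + neg (toℕ x)
    edge-in-factor : (∃ λ c → Transversal c × ∃ λ σ → σ ∈ S × u ≋ c * σ) → ∃ λ i → factor i x y ≡ true
    edge-in-factor (c , Tc , σ , σ∈S , u≋cσ) = i , scaled-edge⁺ {multiplier i} {S} {x} {y} {σ} σ∈S (begin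
      toℕ x + multiplier i * σ      ≡⟨ cong (λ c′ → toℕ x + c′ * σ) (Anyₚ.lookup-index c∈transversalElements) ⟨
      toℕ x + c * σ                 ≈⟨ +-congˡ (toℕ x) u≋cσ ⟨
      toℕ x + u                     ≈⟨ difference-translate x y ⟩
      toℕ y                         ∎)
      where
      open ≋-Reasoning
      c∈transversalElements : c ∈ transversalElements
      c∈transversalElements = ∈-filter⁺ Transversal? (∈-upTo⁺ (proj₁ Tc)) Tc
      i : Fin (length transversalElements)
      i = Any.index c∈transversalElements

  factorisation : Factorisation (2 * s) (K p) (Cay p S)
  factorisation = length transversalElements , factor , factor-spanning , factor-regular , factor-≅ , factors-disjoint , factors-cover

lemma1 : (s p a b : ℕ) .{{_ : NonZero p}} → 1 ≤ s → Prime p → (2 * s) ∣ (p ∸ 1)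
    → (d : Fin s → ℕ) → (∀ i → Unit p (d i))
    → 1 ≤ a → 1 ≤ b → 2 * a * b * s ≡ p ∸ 1
    → (∀ i → InPow p b (d i))
    → (∀ i j → i ≢ j → ¬ SameCoset p (b * s) (d i) (d j))
    → Factorisation (2 * s) (K p) (Cay p (plusMinus p d))
lemma1 s p a b 1≤s p-prime _ d _ 1≤a 1≤b 2abs≡p-1 d∈G d-cosets =
  CayleyFactorisation.factorisation p p-prime s a b 1≤s 1≤a 1≤b 2abs≡p-1 d d∈G d-cosets
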